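{- For positive integers $a_1,\dots,a_k$ with $a_1\ge2$, \[ t(a_1,\dots,a_k)=\frac{1}{2^{a_1+\cdots+a_k}}\zeta(a_1,\dots,a_k)-\frac{1}{2^{k-1}}\sum_{\substack{1\le p\le k\\ p\text{ odd}}}L_p\zeta(a_1,\dots,a_k). \]
   Context: $t(a_1,\dots,a_k)=\sum_{n_1>\cdots>n_k\ge1,\ n_j\text{ odd}}n_1^{ -a_1}\cdots n_k^{ -a_k}$ and $\zeta(a_1,\dots,a_k)=\sum_{n_1>\cdots>n_k\ge1}n_1^{ -a_1}\cdots n_k^{ -a_k}$. Alternating multiple zeta values: with some arguments barred, $\zeta(\dots)=\sum_{m_1>\cdots>m_k\ge1}\prod_j\sigma_j(m_j)m_j^{ -a_j}$, where $\sigma_j(m)=(-1)^m$ if the $j$th argument is barred and $1$ otherwise. For $0\le p\le k$, $L_p\zeta(a_1,\dots,a_k)$ is the sum of the $\binom{k}{p}$ alternating multiple zeta values obtained from $\zeta(a_1,\dots,a_k)$ by putting a bar on exactly $p$ of the arguments. -}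

module Defs where

open import Data.Bool using (Bool; true; false; if_then_else_)
open import Data.Nat as ℕ using (ℕ; zero; suc; _%_; _≡ᵇ_)
open import Data.Integer using (+_)
open import Data.List using (List; []; _∷_; length; map; concatMap; foldr)
open import Data.Rational using (ℚ; 0ℚ; 1ℚ; _+_; _*_; _-_; -_; _/_; ∣_∣; _<_)
open import Data.Product using (∃-syntax)

infixr 8 _^ℚ_
_^ℚ_ : ℚ → ℕ → ℚ
q ^ℚ zero  = 1ℚ
q ^ℚ suc n = q * (q ^ℚ n)

sumTo : ℕ → (ℕ → ℚ) → ℚ
sumTo zero    f = 0ℚ
sumTo (suc N) f = sumTo N f + f (suc N)

-- truncated multiple sum:
-- msum N (f₁ ∷ … ∷ f_k) = Σ_{N ≥ n₁ > n₂ > ⋯ > n_k ≥ 1} f₁ n₁ ⋯ f_k n_k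
msum : ℕ → List (ℕ → ℚ) → ℚ
msum N []       = 1ℚ
msum N (f ∷ fs) = sumTo N (λ n → f n * msum (n ℕ.∸ 1) fs)

oddᵇ : ℕ → Bool
oddᵇ n = (n % 2) ≡ᵇ 1

-- 1 / n^a  (n ≥ 1 in all uses; value 0 at n = 0 is irrelevant)
inv-pow : ℕ → ℕ → ℚ
inv-pow zero    a = 0ℚ
inv-pow (suc m) a = (+ 1 / suc m) ^ℚ a

sgn : ℕ → ℚ
sgn n = if oddᵇ n then - 1ℚ else 1ℚ

-- summand of one argument a, barred (b = true) or not
term : Bool → ℕ → ℕ → ℚ
term b a n = (if b then sgn n else 1ℚ) * inv-pow n a

-- summand restricted to odd n, for t(…)
oddTerm : ℕ → ℕ → ℚ
oddTerm a n = if oddᵇ n then inv-pow n a else 0ℚ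

zip-terms : List Bool → List ℕ → List (ℕ → ℚ)
zip-terms (b ∷ bs) (a ∷ as) = term b a ∷ zip-terms bs as
zip-terms _        _        = []

-- truncations (outermost index n₁ ≤ N)
tN : ℕ → List ℕ → ℚ
tN N as = msum N (map oddTerm as)

-- truncated alternating MZV with bar pattern bs (bs has the same length as as)
ζbarN : ℕ → List Bool → List ℕ → ℚ
ζbarN N bs as = msum N (zip-terms bs as)

ζN : ℕ → List ℕ → ℚ
ζN N as = msum N (map (term false) as)

patterns : ℕ → List (List Bool)
patterns zero    = [] ∷ []
patterns (suc k) = concatMap (λ bs → (false ∷ bs) ∷ (true ∷ bs) ∷ []) (patterns k)

countTrue : List Bool → ℕ
countTrue []           = 0
countTrue (true ∷ bs)  = suc (countTrue bs)
countTrue (false ∷ bs) = countTrue bs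

sumList : List ℚ → ℚ
sumList = foldr _+_ 0ℚ

-- L_p ζ(a₁,…,a_k), truncated: sum over the C(k,p) patterns with exactly p bars
LpζN : ℕ → ℕ → List ℕ → ℚ
LpζN N p as =
  sumList (map (λ bs → if countTrue bs ≡ᵇ p then ζbarN N bs as else 0ℚ)
               (patterns (length as)))

weight : List ℕ → ℕ
weight = foldr ℕ._+_ 0

rhsN : ℕ → List ℕ → ℚ
rhsN N as =
  ((+ 1 / 2) ^ℚ weight as) * ζN N as
  - ((+ 1 / 2) ^ℚ (length as ℕ.∸ 1))
    * sumTo (length as) (λ p → if oddᵇ p then LpζN N p as else 0ℚ)

TendsToZero : (ℕ → ℚ) → Set
TendsToZero s = ∀ (ε : ℚ) → 0ℚ < ε → ∃[ M ] (∀ N → M ℕ.≤ N → ∣ s N ∣ < ε)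

{-# OPTIONS --safe #-}
module Submission where

-- Give the n-th summand of each argument the weight 1 + x σ(n), where σ(n) = (−1)^n is the bar
-- sign. Distributing the product over the bar patterns shows that the sum over all patterns of
-- x^(number of bars) · ζ̄ is the truncated multiple sum of the weighted summands. At x = −1 the
-- weight is 2 on odd n and 0 on even n, giving 2^k t_N; at x = 1 it is 2 on even n only, and
-- the substitution n = 2m gives 2^k 2^(−w) ζ_⌊N/2⌋. Half their difference is the sum over
-- patterns with an odd number of bars, i.e. Σ_{p odd} L_p ζ. This yields the exact identity
--   t_N − rhs_N = 2^(−w) (ζ_⌊N/2⌋ − ζ_N).
-- The right side is controlled by the terms of ζ_N with first index in (N/2, N]: since a₁ ≥ 2
-- each is at most (N/2)^(−2) H_N^(k−1), and there are about N/2 of them, so their sum is at most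
-- (N/2)^(−1) H_N^(k−1), which tends to 0 because H_N ≤ log₂ N + 1.

open import Defs
open import Data.Nat using (ℕ; _≤_)
open import Data.List using (List; _∷_)
open import Data.List.Relation.Unary.All using (All)
open import Data.Rational using (_-_)

open import Algebra.Bundles using (CommutativeMonoid)
open import Data.Bool using (Bool; true; false; if_then_else_; not; T)
open import Data.Empty using (⊥-elim)
import Data.Integer as ℤ
open import Data.List using ([]; map; concatMap; length)
import Data.List.Properties as ListP
import Data.List.Relation.Unary.All as All
open import Data.Nat as ℕ using (zero; suc; ⌊_/2⌋; _≡ᵇ_; _^_)
import Data.Nat.Coprimality as Coprime
import Data.Nat.DivMod as ℕDM
import Data.Nat.Properties as ℕP
import Data.Nat.Tactic.RingSolver as ℕSolver
open import Data.Product using (_×_; _,_; proj₁; proj₂; ∃-syntax)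
open import Data.Rational as ℚ using (ℚ; mkℚ; 0ℚ; 1ℚ; ½; _+_; _*_; -_; _/_; ∣_∣)
  renaming (_≤_ to _≤ℚ_; _<_ to _<ℚ_)
import Data.Rational.Properties as ℚP
import Data.Rational.Unnormalised as ℚᵘ
import Data.Rational.Unnormalised.Properties as ℚᵘP
open import Data.Sum using (_⊎_; inj₁; inj₂)
open import Data.Unit using (tt)
open import Function using (_∘_)
open import Level using (0ℓ)
open import Relation.Binary.PropositionalEquality
open import Relation.Nullary using (yes; no)
open import Relation.Nullary.Decidable using (dec⇒maybe)
open import Tactic.RingSolver using (solve-∀)
import Tactic.RingSolver.Core.AlmostCommutativeRing as ACR

open import Algebra.Properties.CommutativeSemigroup
  (CommutativeMonoid.commutativeSemigroup ℚP.+-0-commutativeMonoid) using (interchange)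

ℚ-ring : ACR.AlmostCommutativeRing 0ℓ 0ℓ
ℚ-ring = ACR.fromCommutativeRing ℚP.+-*-commutativeRing (λ x → dec⇒maybe (0ℚ ℚP.≟ x))

-- Finite sums

sumTo-cong : ∀ N {f g : ℕ → ℚ} → (∀ n → f n ≡ g n) → sumTo N f ≡ sumTo N g
sumTo-cong zero    f≗g = refl
sumTo-cong (suc N) f≗g = cong₂ _+_ (sumTo-cong N f≗g) (f≗g (suc N))

sumTo-+ : ∀ N (f g : ℕ → ℚ) → sumTo N (λ n → f n + g n) ≡ sumTo N f + sumTo N g
sumTo-+ zero    f g = refl
sumTo-+ (suc N) f g = trans (cong (_+ (f (suc N) + g (suc N))) (sumTo-+ N f g))
  (interchange (sumTo N f) (sumTo N g) (f (suc N)) (g (suc N)))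

sumTo-*ˡ : ∀ N c (f : ℕ → ℚ) → sumTo N (λ n → c * f n) ≡ c * sumTo N f
sumTo-*ˡ zero    c f = sym (ℚP.*-zeroʳ c)
sumTo-*ˡ (suc N) c f = trans (cong (_+ c * f (suc N)) (sumTo-*ˡ N c f))
  (sym (ℚP.*-distribˡ-+ c (sumTo N f) (f (suc N))))

sumTo-0 : ∀ N → sumTo N (λ _ → 0ℚ) ≡ 0ℚ
sumTo-0 zero    = refl
sumTo-0 (suc N) = cong (_+ 0ℚ) (sumTo-0 N)

sumTo-linear : ∀ N (c d : ℚ) (f g : ℕ → ℚ) →
  c * sumTo N f + d * sumTo N g ≡ sumTo N (λ n → c * f n + d * g n)
sumTo-linear N c d f g =
  sym (trans (sumTo-+ N _ _) (cong₂ _+_ (sumTo-*ˡ N c f) (sumTo-*ˡ N d g)))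

sumOver : {A : Set} → (A → ℚ) → List A → ℚ
sumOver f xs = sumList (map f xs)

sumOver-cong : {A : Set} (xs : List A) {f g : A → ℚ} → (∀ x → f x ≡ g x) →
  sumOver f xs ≡ sumOver g xs
sumOver-cong []       f≗g = refl
sumOver-cong (x ∷ xs) f≗g = cong₂ _+_ (f≗g x) (sumOver-cong xs f≗g)

sumOver-+ : {A : Set} (xs : List A) (f g : A → ℚ) →
  sumOver (λ x → f x + g x) xs ≡ sumOver f xs + sumOver g xs
sumOver-+ []       f g = refl
sumOver-+ (x ∷ xs) f g = trans (cong (f x + g x +_) (sumOver-+ xs f g))
  (interchange (f x) (g x) (sumOver f xs) (sumOver g xs))

sumOver-- : {A : Set} (xs : List A) (f g : A → ℚ) →
  sumOver (λ x → f x - g x) xs ≡ sumOver f xs - sumOver g xs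
sumOver-- []       f g = refl
sumOver-- (x ∷ xs) f g =
  trans (cong (f x - g x +_) (sumOver-- xs f g)) (lemma (f x) (g x) _ _)
  where
  lemma : ∀ u v U V → u - v + (U - V) ≡ u + U - (v + V)
  lemma = solve-∀ ℚ-ring

sumOver-*ˡ : {A : Set} (xs : List A) (c : ℚ) (f : A → ℚ) →
  sumOver (λ x → c * f x) xs ≡ c * sumOver f xs
sumOver-*ˡ []       c f = sym (ℚP.*-zeroʳ c)
sumOver-*ˡ (x ∷ xs) c f = trans (cong (c * f x +_) (sumOver-*ˡ xs c f))
  (sym (ℚP.*-distribˡ-+ c (f x) (sumOver f xs)))

sumOver-0 : {A : Set} (xs : List A) → sumOver (λ _ → 0ℚ) xs ≡ 0ℚ
sumOver-0 []       = refl
sumOver-0 (x ∷ xs) = cong (0ℚ +_) (sumOver-0 xs)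

sumOver-sumTo-comm : {A : Set} (xs : List A) (N : ℕ) (g : A → ℕ → ℚ) →
  sumOver (λ x → sumTo N (g x)) xs ≡ sumTo N (λ n → sumOver (λ x → g x n) xs)
sumOver-sumTo-comm []       N g = sym (sumTo-0 N)
sumOver-sumTo-comm (x ∷ xs) N g =
  trans (cong (sumTo N (g x) +_) (sumOver-sumTo-comm xs N g))
        (sym (sumTo-+ N (g x) (λ n → sumOver (λ y → g y n) xs)))

sumOver-concatMap-pair : {A B : Set} (f : B → ℚ) (g h : A → B) (xs : List A) →
  sumOver f (concatMap (λ x → g x ∷ h x ∷ []) xs) ≡ sumOver (λ x → f (g x) + f (h x)) xs
sumOver-concatMap-pair f g h []       = refl
sumOver-concatMap-pair f g h (x ∷ xs) =
  trans (cong (λ s → f (g x) + (f (h x) + s)) (sumOver-concatMap-pair f g h xs))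
        (sym (ℚP.+-assoc (f (g x)) (f (h x)) _))

sumOver-patterns-suc : ∀ k (f : List Bool → ℚ) →
  sumOver f (patterns (suc k)) ≡ sumOver (λ bs → f (false ∷ bs) + f (true ∷ bs)) (patterns k)
sumOver-patterns-suc k f = sumOver-concatMap-pair f (false ∷_) (true ∷_) (patterns k)

sumOver-patterns-cong : ∀ k (f g : List Bool → ℚ) →
  (∀ bs → countTrue bs ℕ.≤ k → f bs ≡ g bs) → sumOver f (patterns k) ≡ sumOver g (patterns k)
sumOver-patterns-cong zero    f g f≗g = cong (_+ 0ℚ) (f≗g [] ℕ.z≤n)
sumOver-patterns-cong (suc k) f g f≗g = begin
    sumOver f (patterns (suc k))
  ≡⟨ sumOver-patterns-suc k f ⟩
    sumOver (λ bs → f (false ∷ bs) + f (true ∷ bs)) (patterns k)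
  ≡⟨ sumOver-patterns-cong k _ _ (λ bs ≤k →
       cong₂ _+_ (f≗g (false ∷ bs) (ℕP.m≤n⇒m≤1+n ≤k)) (f≗g (true ∷ bs) (ℕ.s≤s ≤k))) ⟩
    sumOver (λ bs → g (false ∷ bs) + g (true ∷ bs)) (patterns k)
  ≡⟨ sumOver-patterns-suc k g ⟨
    sumOver g (patterns (suc k))
  ∎
  where open ≡-Reasoning

≡ᵇ-refl : ∀ n → (n ≡ᵇ n) ≡ true
≡ᵇ-refl zero    = refl
≡ᵇ-refl (suc n) = ≡ᵇ-refl n

≢⇒≡ᵇ-false : ∀ m n → m ≢ n → (m ≡ᵇ n) ≡ false
≢⇒≡ᵇ-false m n m≢n with m ≡ᵇ n in eq
... | false = refl
... | true  = ⊥-elim (m≢n (ℕP.≡ᵇ⇒≡ m n (subst T (sym eq) tt)))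

sumTo-indicator-beyond : ∀ k c (Y : ℕ → ℚ) → k ℕ.< c →
  sumTo k (λ p → if c ≡ᵇ p then Y p else 0ℚ) ≡ 0ℚ
sumTo-indicator-beyond zero    c Y k<c = refl
sumTo-indicator-beyond (suc k) c Y k<c
  rewrite ≢⇒≡ᵇ-false c (suc k) (λ c≡k → ℕP.<-irrefl (sym c≡k) k<c) =
  cong (_+ 0ℚ) (sumTo-indicator-beyond k c Y (ℕP.<-trans (ℕP.n<1+n k) k<c))

sumTo-indicator : ∀ k c (Y : ℕ → ℚ) → Y 0 ≡ 0ℚ → c ℕ.≤ k →
  sumTo k (λ p → if c ≡ᵇ p then Y p else 0ℚ) ≡ Y c
sumTo-indicator zero    .zero Y Y0≡0 ℕ.z≤n = sym Y0≡0
sumTo-indicator (suc k) c     Y Y0≡0 c≤k with c ℕ.≟ suc k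
... | yes refl rewrite ≡ᵇ-refl k =
  trans (cong (_+ Y (suc k)) (sumTo-indicator-beyond k (suc k) Y (ℕP.n<1+n k))) (ℚP.+-identityˡ _)
... | no c≢k rewrite ≢⇒≡ᵇ-false c (suc k) c≢k =
  trans (ℚP.+-identityʳ _) (sumTo-indicator k c Y Y0≡0 (ℕP.≤-pred (ℕP.≤∧≢⇒< c≤k c≢k)))

-- Powers, natural numbers and reciprocals

^ℚ-+ : ∀ x m n → x ^ℚ (m ℕ.+ n) ≡ (x ^ℚ m) * (x ^ℚ n)
^ℚ-+ x zero    n = sym (ℚP.*-identityˡ _)
^ℚ-+ x (suc m) n = trans (cong (x *_) (^ℚ-+ x m n)) (sym (ℚP.*-assoc x _ _))

^ℚ-distrib-* : ∀ x y n → (x * y) ^ℚ n ≡ (x ^ℚ n) * (y ^ℚ n)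
^ℚ-distrib-* x y zero    = refl
^ℚ-distrib-* x y (suc n) = trans (cong (x * y *_) (^ℚ-distrib-* x y n)) (lemma x y _ _)
  where
  lemma : ∀ x y u v → x * y * (u * v) ≡ x * u * (y * v)
  lemma = solve-∀ ℚ-ring

1^ℚ : ∀ n → 1ℚ ^ℚ n ≡ 1ℚ
1^ℚ zero    = refl
1^ℚ (suc n) = cong (1ℚ *_) (1^ℚ n)

2ℚ : ℚ
2ℚ = 1ℚ + 1ℚ

½^n*2^n : ∀ n → (½ ^ℚ n) * (2ℚ ^ℚ n) ≡ 1ℚ
½^n*2^n n = trans (sym (^ℚ-distrib-* ½ 2ℚ n)) (1^ℚ n)

-- An n-fold sum of 1ℚ, so that additivity and multiplicativity follow by induction.
fromℕ : ℕ → ℚ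
fromℕ n = sumTo n (λ _ → 1ℚ)

fromℕ-+ : ∀ m n → fromℕ (m ℕ.+ n) ≡ fromℕ m + fromℕ n
fromℕ-+ zero    n = sym (ℚP.+-identityˡ (fromℕ n))
fromℕ-+ (suc m) n = trans (cong (_+ 1ℚ) (fromℕ-+ m n)) (lemma (fromℕ m) (fromℕ n))
  where
  lemma : ∀ x y → x + y + 1ℚ ≡ x + 1ℚ + y
  lemma = solve-∀ ℚ-ring

fromℕ-* : ∀ m n → fromℕ (m ℕ.* n) ≡ fromℕ m * fromℕ n
fromℕ-* zero    n = sym (ℚP.*-zeroˡ (fromℕ n))
fromℕ-* (suc m) n = begin
  fromℕ (n ℕ.+ m ℕ.* n)     ≡⟨ fromℕ-+ n (m ℕ.* n) ⟩
  fromℕ n + fromℕ (m ℕ.* n) ≡⟨ cong (fromℕ n +_) (fromℕ-* m n) ⟩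
  fromℕ n + fromℕ m * fromℕ n ≡⟨ lemma (fromℕ m) (fromℕ n) ⟩
  (fromℕ m + 1ℚ) * fromℕ n  ∎
  where
  open ≡-Reasoning
  lemma : ∀ x y → y + x * y ≡ (x + 1ℚ) * y
  lemma = solve-∀ ℚ-ring

fromℕ-^ : ∀ x m → fromℕ x ^ℚ m ≡ fromℕ (x ^ m)
fromℕ-^ x zero    = refl
fromℕ-^ x (suc m) = trans (cong (fromℕ x *_) (fromℕ-^ x m)) (sym (fromℕ-* x (x ^ m)))

fromℕ-suc-normal : ∀ m →
  fromℕ (suc m) ≡ mkℚ (ℤ.+ suc m) 0 (Coprime.sym (Coprime.1-coprimeTo (suc m)))
fromℕ-suc-normal m = ℚP.toℚᵘ-injective (unnormalised m)
  where
  unnormalised : ∀ m → ℚ.toℚᵘ (fromℕ (suc m)) ℚᵘ.≃ ℚᵘ.mkℚᵘ (ℤ.+ suc m) 0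
  unnormalised zero    = ℚᵘ.*≡* refl
  unnormalised (suc m) = ℚᵘP.≃-trans (ℚP.toℚᵘ-homo-+ (fromℕ (suc m)) 1ℚ)
    (ℚᵘP.≃-trans (ℚᵘP.+-cong (unnormalised m) (ℚᵘP.≃-refl {ℚᵘ.mkℚᵘ (ℤ.+ 1) 0}))
                 (ℚᵘ.*≡* (cong ℤ.+_ (ℕSolver.solve (m ∷ [])))))

1/suc : ℕ → ℚ
1/suc m = ℤ.+ 1 / suc m

fromℕ*1/suc : ∀ m → fromℕ (suc m) * 1/suc m ≡ 1ℚ
fromℕ*1/suc m =
  trans (cong₂ _*_ (fromℕ-suc-normal m) (ℚP.normalize-coprime (Coprime.1-coprimeTo (suc m))))
        (ℚP.*-inverseʳ (mkℚ (ℤ.+ suc m) 0 (Coprime.sym (Coprime.1-coprimeTo (suc m)))))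

inverse-unique : ∀ {x y n : ℚ} → x * n ≡ 1ℚ → y * n ≡ 1ℚ → x ≡ y
inverse-unique {x} {y} {n} xn≡1 yn≡1 = begin
  x            ≡⟨ sym (ℚP.*-identityʳ x) ⟩
  x * 1ℚ       ≡⟨ cong (x *_) (sym yn≡1) ⟩
  x * (y * n)  ≡⟨ lemma x y n ⟩
  y * (x * n)  ≡⟨ cong (y *_) xn≡1 ⟩
  y * 1ℚ       ≡⟨ ℚP.*-identityʳ y ⟩
  y            ∎
  where
  open ≡-Reasoning
  lemma : ∀ x y n → x * (y * n) ≡ y * (x * n)
  lemma = solve-∀ ℚ-ring

1/suc-double : ∀ m → 1/suc (suc (m ℕ.+ m)) ≡ ½ * 1/suc m
1/suc-double m = inverse-unique
  (trans (ℚP.*-comm _ (fromℕ (suc (suc (m ℕ.+ m))))) (fromℕ*1/suc (suc (m ℕ.+ m))))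
  (begin
    ½ * 1/suc m * fromℕ (suc (suc (m ℕ.+ m)))
  ≡⟨ cong (λ k → ½ * 1/suc m * fromℕ (suc k)) (sym (ℕP.+-suc m m)) ⟩
    ½ * 1/suc m * fromℕ (suc m ℕ.+ suc m)
  ≡⟨ cong (½ * 1/suc m *_) (fromℕ-+ (suc m) (suc m)) ⟩
    ½ * 1/suc m * (fromℕ (suc m) + fromℕ (suc m))
  ≡⟨ lemma (1/suc m) (fromℕ (suc m)) ⟩
    fromℕ (suc m) * 1/suc m
  ≡⟨ fromℕ*1/suc m ⟩
    1ℚ
  ∎)
  where
  open ≡-Reasoning
  lemma : ∀ r n → ½ * r * (n + n) ≡ n * r
  lemma = solve-∀ ℚ-ring

inv-pow-double : ∀ m a → inv-pow (suc m ℕ.+ suc m) a ≡ (½ ^ℚ a) * inv-pow (suc m) a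
inv-pow-double m a = trans (cong (λ k → inv-pow (suc k) a) (ℕP.+-suc m m))
  (trans (cong (_^ℚ a) (1/suc-double m)) (^ℚ-distrib-* ½ (1/suc m) a))

-- Parity and halving

oddᵇ-suc-suc : ∀ n → oddᵇ (suc (suc n)) ≡ oddᵇ n
oddᵇ-suc-suc n =
  cong (_≡ᵇ 1) (trans (cong (ℕ._% 2) (ℕP.+-comm 2 n)) (ℕDM.[m+n]%n≡m%n n 2))

oddᵇ-suc : ∀ n → oddᵇ (suc n) ≡ not (oddᵇ n)
oddᵇ-suc zero          = refl
oddᵇ-suc (suc zero)    = refl
oddᵇ-suc (suc (suc n)) = trans (oddᵇ-suc-suc (suc n))
  (trans (oddᵇ-suc n) (cong not (sym (oddᵇ-suc-suc n))))

oddᵇ-double : ∀ m → oddᵇ (m ℕ.+ m) ≡ false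
oddᵇ-double zero    = refl
oddᵇ-double (suc m) = trans (cong (oddᵇ ∘ suc) (ℕP.+-suc m m))
  (trans (oddᵇ-suc-suc (m ℕ.+ m)) (oddᵇ-double m))

oddᵇ-suc-double : ∀ m → oddᵇ (suc (m ℕ.+ m)) ≡ true
oddᵇ-suc-double m = trans (oddᵇ-suc (m ℕ.+ m)) (cong not (oddᵇ-double m))

-1^ℚ≡sgn : ∀ n → (- 1ℚ) ^ℚ n ≡ sgn n
-1^ℚ≡sgn zero    = refl
-1^ℚ≡sgn (suc n) rewrite -1^ℚ≡sgn n | oddᵇ-suc n with oddᵇ n
... | true  = refl
... | false = refl

⌊1+n+n/2⌋≡n : ∀ n → ⌊ suc (n ℕ.+ n) /2⌋ ≡ n
⌊1+n+n/2⌋≡n zero    = refl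
⌊1+n+n/2⌋≡n (suc n) =
  trans (cong (λ k → ⌊ suc (suc k) /2⌋) (ℕP.+-suc n n)) (cong suc (⌊1+n+n/2⌋≡n n))

n≡2⌊n/2⌋⊎n≡1+2⌊n/2⌋ : ∀ n → n ≡ ⌊ n /2⌋ ℕ.+ ⌊ n /2⌋ ⊎ n ≡ suc (⌊ n /2⌋ ℕ.+ ⌊ n /2⌋)
n≡2⌊n/2⌋⊎n≡1+2⌊n/2⌋ zero          = inj₁ refl
n≡2⌊n/2⌋⊎n≡1+2⌊n/2⌋ (suc zero)    = inj₂ refl
n≡2⌊n/2⌋⊎n≡1+2⌊n/2⌋ (suc (suc n)) with n≡2⌊n/2⌋⊎n≡1+2⌊n/2⌋ n
... | inj₁ e = inj₁ (trans (cong (suc ∘ suc) e) (cong suc (sym (ℕP.+-suc ⌊ n /2⌋ ⌊ n /2⌋))))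
... | inj₂ e = inj₂ (cong (suc ∘ suc) (trans e (sym (ℕP.+-suc ⌊ n /2⌋ ⌊ n /2⌋))))

2⌊n/2⌋≤n : ∀ n → ⌊ n /2⌋ ℕ.+ ⌊ n /2⌋ ℕ.≤ n
2⌊n/2⌋≤n n with n≡2⌊n/2⌋⊎n≡1+2⌊n/2⌋ n
... | inj₁ e = ℕP.≤-reflexive (sym e)
... | inj₂ e = ℕP.≤-trans (ℕP.n≤1+n _) (ℕP.≤-reflexive (sym e))

⌊n/2⌋≤n : ∀ n → ⌊ n /2⌋ ℕ.≤ n
⌊n/2⌋≤n n = ℕP.≤-trans (ℕP.m≤m+n ⌊ n /2⌋ ⌊ n /2⌋) (2⌊n/2⌋≤n n)

n≤1+2⌊n/2⌋ : ∀ n → n ℕ.≤ suc (⌊ n /2⌋ ℕ.+ ⌊ n /2⌋)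
n≤1+2⌊n/2⌋ n with n≡2⌊n/2⌋⊎n≡1+2⌊n/2⌋ n
... | inj₁ e = ℕP.≤-trans (ℕP.≤-reflexive e) (ℕP.n≤1+n _)
... | inj₂ e = ℕP.≤-reflexive e

n∸⌊n/2⌋≤1+⌊n/2⌋ : ∀ n → n ℕ.∸ ⌊ n /2⌋ ℕ.≤ suc ⌊ n /2⌋
n∸⌊n/2⌋≤1+⌊n/2⌋ n = ℕP.≤-trans (ℕP.∸-monoˡ-≤ ⌊ n /2⌋ (n≤1+2⌊n/2⌋ n))
  (ℕP.≤-reflexive (ℕP.m+n∸n≡m (suc ⌊ n /2⌋) ⌊ n /2⌋))

n<m+m⇒⌊n/2⌋<m : ∀ n m → n ℕ.< m ℕ.+ m → ⌊ n /2⌋ ℕ.< m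
n<m+m⇒⌊n/2⌋<m n m n<2m with ⌊ n /2⌋ ℕ.<? m
... | yes h<m = h<m
... | no  h≮m = ⊥-elim (ℕP.<⇒≱ n<2m (ℕP.≤-trans (ℕP.+-mono-≤ m≤h m≤h) (2⌊n/2⌋≤n n)))
  where
  m≤h : m ℕ.≤ ⌊ n /2⌋
  m≤h = ℕP.≮⇒≥ h≮m

m+m≤n⇒m≤⌊n/2⌋ : ∀ m n → m ℕ.+ m ℕ.≤ n → m ℕ.≤ ⌊ n /2⌋
m+m≤n⇒m≤⌊n/2⌋ m n 2m≤n with m ℕ.≤? ⌊ n /2⌋
... | yes m≤h = m≤h
... | no  m≰h = ⊥-elim (ℕP.<⇒≱ n<2m 2m≤n)
  where
  n<2m : n ℕ.< m ℕ.+ m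
  n<2m = ℕP.≤-trans (ℕ.s≤s (n≤1+2⌊n/2⌋ n))
           (ℕP.≤-trans (ℕP.≤-reflexive (cong suc (sym (ℕP.+-suc ⌊ n /2⌋ ⌊ n /2⌋))))
                       (ℕP.+-mono-≤ (ℕP.≰⇒> m≰h) (ℕP.≰⇒> m≰h)))

2^suc : ∀ n → 2 ^ suc n ≡ 2 ^ n ℕ.+ 2 ^ n
2^suc n = cong (2 ^ n ℕ.+_) (ℕP.+-identityʳ (2 ^ n))

1≤2^n : ∀ n → 1 ℕ.≤ 2 ^ n
1≤2^n n = ℕP.^-monoʳ-≤ 2 {0} {n} ℕ.z≤n

n<2^n : ∀ n → n ℕ.< 2 ^ n
n<2^n zero    = ℕ.s≤s ℕ.z≤n
n<2^n (suc n) = ℕP.≤-trans (ℕP.+-mono-≤ (1≤2^n n) (n<2^n n)) (ℕP.≤-reflexive (sym (2^suc n)))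

2^a≤n<2^[1+b]⇒a≤b : ∀ {a b n} → 2 ^ a ℕ.≤ n → n ℕ.< 2 ^ suc b → a ℕ.≤ b
2^a≤n<2^[1+b]⇒a≤b {a} {b} 2^a≤n n<2^[1+b] with a ℕ.≤? b
... | yes a≤b = a≤b
... | no  a≰b = ⊥-elim (ℕP.<⇒≱ n<2^[1+b] (ℕP.≤-trans (ℕP.^-monoʳ-≤ 2 (ℕP.≰⇒> a≰b)) 2^a≤n))

dyadic-bracket : ∀ N → 1 ℕ.≤ N → ∃[ L ] 2 ^ L ℕ.≤ N × N ℕ.< 2 ^ suc L
dyadic-bracket (suc zero)    _ = 0 , ℕP.≤-refl , ℕP.≤-refl
dyadic-bracket (suc (suc N)) _ with dyadic-bracket (suc N) (ℕ.s≤s ℕ.z≤n)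
... | L , 2^L≤N , N<2^[1+L] with suc (suc N) ℕ.<? 2 ^ suc L
...   | yes N+1<2^[1+L] = L , ℕP.m≤n⇒m≤1+n 2^L≤N , N+1<2^[1+L]
...   | no  N+1≮2^[1+L] = suc L , ℕP.≮⇒≥ N+1≮2^[1+L] , (begin-strict
          suc (suc N)              <⟨ ℕ.s≤s N<2^[1+L] ⟩
          suc (2 ^ suc L)          ≤⟨ ℕP.+-monoˡ-≤ (2 ^ suc L) (1≤2^n (suc L)) ⟩
          2 ^ suc L ℕ.+ 2 ^ suc L  ≡⟨ 2^suc (suc L) ⟨
          2 ^ suc (suc L)          ∎)
  where open ℕP.≤-Reasoning

-- Summing over bar patterns

barSummand : ℚ → ℕ → ℕ → ℚ
barSummand x a n = term false a n + x * term true a n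

patternSum : ℚ → ℕ → List ℕ → ℚ
patternSum x N as = sumOver (λ bs → (x ^ℚ countTrue bs) * ζbarN N bs as) (patterns (length as))

patternSum-expansion : ∀ x as N → patternSum x N as ≡ msum N (map (barSummand x) as)
patternSum-expansion x []       N = trans (ℚP.+-identityʳ _) (ℚP.*-identityˡ _)
patternSum-expansion x (a ∷ as) N = begin
    patternSum x N (a ∷ as)
  ≡⟨ sumOver-patterns-suc (length as) _ ⟩
    sumOver (λ bs → w bs * sumTo N (λ n → term false a n * M n bs)
                  + x * w bs * sumTo N (λ n → term true a n * M n bs)) pats
  ≡⟨ sumOver-cong pats (λ bs → trans (sumTo-linear N (w bs) (x * w bs) _ _)
                                     (sumTo-cong N (λ n → factor (w bs) (M n bs) n))) ⟩
    sumOver (λ bs → sumTo N (λ n → barSummand x a n * (w bs * M n bs))) pats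
  ≡⟨ sumOver-sumTo-comm pats N _ ⟩
    sumTo N (λ n → sumOver (λ bs → barSummand x a n * (w bs * M n bs)) pats)
  ≡⟨ sumTo-cong N (λ n → trans (sumOver-*ˡ pats (barSummand x a n) _)
                               (cong (barSummand x a n *_) (patternSum-expansion x as (n ℕ.∸ 1)))) ⟩
    msum N (map (barSummand x) (a ∷ as))
  ∎
  where
  open ≡-Reasoning
  pats : List (List Bool)
  pats = patterns (length as)
  w : List Bool → ℚ
  w bs = x ^ℚ countTrue bs
  M : ℕ → List Bool → ℚ
  M n bs = msum (n ℕ.∸ 1) (zip-terms bs as)
  factor : ∀ c m n →
    c * (term false a n * m) + x * c * (term true a n * m) ≡ barSummand x a n * (c * m)
  factor c m n = lemma x c m (term false a n) (term true a n)
    where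
    lemma : ∀ x c m u v → c * (u * m) + x * c * (v * m) ≡ (u + x * v) * (c * m)
    lemma = solve-∀ ℚ-ring

msum-cong : ∀ as N {f g : ℕ → ℕ → ℚ} → (∀ a n → f a n ≡ g a n) →
  msum N (map f as) ≡ msum N (map g as)
msum-cong []       N f≗g = refl
msum-cong (a ∷ as) N f≗g =
  sumTo-cong N (λ n → cong₂ _*_ (f≗g a n) (msum-cong as (n ℕ.∸ 1) f≗g))

msum-scale : ∀ as N (c : ℚ) (f : ℕ → ℕ → ℚ) →
  msum N (map (λ a n → c * f a n) as) ≡ (c ^ℚ length as) * msum N (map f as)
msum-scale []       N c f = sym (ℚP.*-identityˡ _)
msum-scale (a ∷ as) N c f = trans
  (sumTo-cong N (λ n → trans (cong (c * f a n *_) (msum-scale as (n ℕ.∸ 1) c f))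
                             (lemma c (f a n) _ _)))
  (sumTo-*ˡ N (c * (c ^ℚ length as)) _)
  where
  lemma : ∀ c u p m → c * u * (p * m) ≡ c * p * (u * m)
  lemma = solve-∀ ℚ-ring

evenPart : (ℕ → ℚ) → ℕ → ℚ
evenPart G n = if oddᵇ n then 0ℚ else G n

evenPart-double : ∀ G h → evenPart G (h ℕ.+ h) ≡ G (h ℕ.+ h)
evenPart-double G h rewrite oddᵇ-double h = refl

evenPart-suc-double : ∀ G h → evenPart G (suc (h ℕ.+ h)) ≡ 0ℚ
evenPart-suc-double G h rewrite oddᵇ-suc-double h = refl

evenPart-*ʳ : ∀ (f g : ℕ → ℚ) n → evenPart f n * g n ≡ evenPart (λ k → f k * g k) n
evenPart-*ʳ f g n with oddᵇ n
... | true  = ℚP.*-zeroˡ (g n)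
... | false = refl

evenPart-pair : ∀ G N →
  evenPart G (suc N) + evenPart G (suc (suc N)) ≡ G (suc ⌊ N /2⌋ ℕ.+ suc ⌊ N /2⌋)
evenPart-pair G N with n≡2⌊n/2⌋⊎n≡1+2⌊n/2⌋ N
... | inj₁ N≡2h = subst Pair (sym N≡2h) (begin
    evenPart G (suc (h ℕ.+ h)) + evenPart G (suc (suc (h ℕ.+ h)))
  ≡⟨ cong₂ _+_ (evenPart-suc-double G h) (cong (evenPart G) (sym 2[1+h]≡)) ⟩
    0ℚ + evenPart G (suc h ℕ.+ suc h)
  ≡⟨ trans (ℚP.+-identityˡ _) (evenPart-double G (suc h)) ⟩
    G (suc h ℕ.+ suc h)
  ∎)
  where
  open ≡-Reasoning
  h = ⌊ N /2⌋
  Pair : ℕ → Set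
  Pair n = evenPart G (suc n) + evenPart G (suc (suc n)) ≡ G (suc h ℕ.+ suc h)
  2[1+h]≡ : suc h ℕ.+ suc h ≡ suc (suc (h ℕ.+ h))
  2[1+h]≡ = cong suc (ℕP.+-suc h h)
... | inj₂ N≡1+2h = subst Pair (sym N≡1+2h) (begin
    evenPart G (suc (suc (h ℕ.+ h))) + evenPart G (suc (suc (suc (h ℕ.+ h))))
  ≡⟨ cong₂ _+_ (cong (evenPart G) (sym 2[1+h]≡)) (cong (evenPart G ∘ suc) (sym 2[1+h]≡)) ⟩
    evenPart G (suc h ℕ.+ suc h) + evenPart G (suc (suc h ℕ.+ suc h))
  ≡⟨ cong₂ _+_ (evenPart-double G (suc h)) (evenPart-suc-double G (suc h)) ⟩
    G (suc h ℕ.+ suc h) + 0ℚ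
  ≡⟨ ℚP.+-identityʳ _ ⟩
    G (suc h ℕ.+ suc h)
  ∎)
  where
  open ≡-Reasoning
  h = ⌊ N /2⌋
  Pair : ℕ → Set
  Pair n = evenPart G (suc n) + evenPart G (suc (suc n)) ≡ G (suc h ℕ.+ suc h)
  2[1+h]≡ : suc h ℕ.+ suc h ≡ suc (suc (h ℕ.+ h))
  2[1+h]≡ = cong suc (ℕP.+-suc h h)

sumTo-evenPart : ∀ G N → sumTo N (evenPart G) ≡ sumTo ⌊ N /2⌋ (λ m → G (m ℕ.+ m))
sumTo-evenPart G zero          = refl
sumTo-evenPart G (suc zero)    = refl
sumTo-evenPart G (suc (suc N)) = begin
    sumTo N (evenPart G) + evenPart G (suc N) + evenPart G (suc (suc N))
  ≡⟨ ℚP.+-assoc (sumTo N (evenPart G)) _ _ ⟩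
    sumTo N (evenPart G) + (evenPart G (suc N) + evenPart G (suc (suc N)))
  ≡⟨ cong₂ _+_ (sumTo-evenPart G N) (evenPart-pair G N) ⟩
    sumTo (suc ⌊ N /2⌋) (λ m → G (m ℕ.+ m))
  ∎
  where open ≡-Reasoning

evenTerm : ℕ → ℕ → ℚ
evenTerm a = evenPart (λ n → inv-pow n a)

msum-evenTerm : ∀ as N → msum N (map evenTerm as) ≡ (½ ^ℚ weight as) * ζN ⌊ N /2⌋ as
msum-evenTerm []       N = refl
msum-evenTerm (a ∷ as) N = begin
    sumTo N (λ n → evenTerm a n * msum (n ℕ.∸ 1) (map evenTerm as))
  ≡⟨ sumTo-cong N (λ n → cong (evenTerm a n *_) (msum-evenTerm as (n ℕ.∸ 1))) ⟩
    sumTo N (λ n → evenTerm a n * Z n)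
  ≡⟨ sumTo-cong N (evenPart-*ʳ (λ n → inv-pow n a) Z) ⟩
    sumTo N (evenPart G)
  ≡⟨ sumTo-evenPart G N ⟩
    sumTo ⌊ N /2⌋ (λ m → G (m ℕ.+ m))
  ≡⟨ sumTo-cong ⌊ N /2⌋ G-double ⟩
    sumTo ⌊ N /2⌋ (λ m → ½^[a+w] * (term false a m * ζN (m ℕ.∸ 1) as))
  ≡⟨ sumTo-*ˡ ⌊ N /2⌋ ½^[a+w] _ ⟩
    ½^[a+w] * ζN ⌊ N /2⌋ (a ∷ as)
  ∎
  where
  open ≡-Reasoning
  ½^[a+w] : ℚ
  ½^[a+w] = ½ ^ℚ (a ℕ.+ weight as)
  Z : ℕ → ℚ
  Z n = (½ ^ℚ weight as) * ζN ⌊ n ℕ.∸ 1 /2⌋ as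
  G : ℕ → ℚ
  G n = inv-pow n a * Z n
  G-double : ∀ m → G (m ℕ.+ m) ≡ ½^[a+w] * (term false a m * ζN (m ℕ.∸ 1) as)
  G-double zero    = trans (ℚP.*-zeroˡ (Z 0))
    (sym (trans (cong (½^[a+w] *_) (ℚP.*-zeroˡ (ζN 0 as))) (ℚP.*-zeroʳ ½^[a+w])))
  G-double (suc j) = begin
      inv-pow (suc j ℕ.+ suc j) a * ((½ ^ℚ weight as) * ζN ⌊ j ℕ.+ suc j /2⌋ as)
    ≡⟨ cong₂ (λ u k → u * ((½ ^ℚ weight as) * ζN ⌊ k /2⌋ as)) (inv-pow-double j a) (ℕP.+-suc j j) ⟩
      (½ ^ℚ a) * inv-pow (suc j) a * ((½ ^ℚ weight as) * ζN ⌊ suc (j ℕ.+ j) /2⌋ as)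
    ≡⟨ cong (λ k → (½ ^ℚ a) * inv-pow (suc j) a * ((½ ^ℚ weight as) * ζN k as)) (⌊1+n+n/2⌋≡n j) ⟩
      (½ ^ℚ a) * inv-pow (suc j) a * ((½ ^ℚ weight as) * ζN j as)
    ≡⟨ lemma (½ ^ℚ a) (½ ^ℚ weight as) (inv-pow (suc j) a) (ζN j as) ⟩
      (½ ^ℚ a) * (½ ^ℚ weight as) * (1ℚ * inv-pow (suc j) a * ζN j as)
    ≡⟨ cong (_* (1ℚ * inv-pow (suc j) a * ζN j as)) (sym (^ℚ-+ ½ a (weight as))) ⟩
      ½^[a+w] * (1ℚ * inv-pow (suc j) a * ζN j as)
    ∎
    where
    lemma : ∀ p c i z → p * i * (c * z) ≡ p * c * (1ℚ * i * z)
    lemma = solve-∀ ℚ-ring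

barSummand-1 : ∀ a n → barSummand 1ℚ a n ≡ 2ℚ * evenTerm a n
barSummand-1 a n with oddᵇ n
... | true  = lemma (inv-pow n a)
  where
  lemma : ∀ i → 1ℚ * i + 1ℚ * (- 1ℚ * i) ≡ 2ℚ * 0ℚ
  lemma = solve-∀ ℚ-ring
... | false = lemma (inv-pow n a)
  where
  lemma : ∀ i → 1ℚ * i + 1ℚ * (1ℚ * i) ≡ 2ℚ * i
  lemma = solve-∀ ℚ-ring

barSummand-−1 : ∀ a n → barSummand (- 1ℚ) a n ≡ 2ℚ * oddTerm a n
barSummand-−1 a n with oddᵇ n
... | true  = lemma (inv-pow n a)
  where
  lemma : ∀ i → 1ℚ * i + - 1ℚ * (- 1ℚ * i) ≡ 2ℚ * i
  lemma = solve-∀ ℚ-ring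
... | false = lemma (inv-pow n a)
  where
  lemma : ∀ i → 1ℚ * i + - 1ℚ * (1ℚ * i) ≡ 2ℚ * 0ℚ
  lemma = solve-∀ ℚ-ring

patternSum-1 : ∀ as N →
  patternSum 1ℚ N as ≡ (2ℚ ^ℚ length as) * ((½ ^ℚ weight as) * ζN ⌊ N /2⌋ as)
patternSum-1 as N = begin
  patternSum 1ℚ N as                            ≡⟨ patternSum-expansion 1ℚ as N ⟩
  msum N (map (barSummand 1ℚ) as)               ≡⟨ msum-cong as N barSummand-1 ⟩
  msum N (map (λ a n → 2ℚ * evenTerm a n) as)   ≡⟨ msum-scale as N 2ℚ evenTerm ⟩
  (2ℚ ^ℚ length as) * msum N (map evenTerm as)  ≡⟨ cong ((2ℚ ^ℚ length as) *_) (msum-evenTerm as N) ⟩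
  (2ℚ ^ℚ length as) * ((½ ^ℚ weight as) * ζN ⌊ N /2⌋ as) ∎
  where open ≡-Reasoning

patternSum-−1 : ∀ as N → patternSum (- 1ℚ) N as ≡ (2ℚ ^ℚ length as) * tN N as
patternSum-−1 as N = begin
  patternSum (- 1ℚ) N as                       ≡⟨ patternSum-expansion (- 1ℚ) as N ⟩
  msum N (map (barSummand (- 1ℚ)) as)          ≡⟨ msum-cong as N barSummand-−1 ⟩
  msum N (map (λ a n → 2ℚ * oddTerm a n) as)   ≡⟨ msum-scale as N 2ℚ oddTerm ⟩
  (2ℚ ^ℚ length as) * tN N as                  ∎
  where open ≡-Reasoning

oddIndicator : ∀ c X → (if oddᵇ c then X else 0ℚ) ≡ ½ * ((1ℚ ^ℚ c) * X - ((- 1ℚ) ^ℚ c) * X)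
oddIndicator c X rewrite 1^ℚ c | -1^ℚ≡sgn c with oddᵇ c
... | true  = lemma X
  where
  lemma : ∀ X → X ≡ ½ * (1ℚ * X - - 1ℚ * X)
  lemma = solve-∀ ℚ-ring
... | false = lemma X
  where
  lemma : ∀ X → 0ℚ ≡ ½ * (1ℚ * X - 1ℚ * X)
  lemma = solve-∀ ℚ-ring

oddPatternSum : ∀ as N →
  sumOver (λ bs → if oddᵇ (countTrue bs) then ζbarN N bs as else 0ℚ) (patterns (length as))
  ≡ ½ * (patternSum 1ℚ N as - patternSum (- 1ℚ) N as)
oddPatternSum as N = begin
    sumOver (λ bs → if oddᵇ (countTrue bs) then X bs else 0ℚ) pats
  ≡⟨ sumOver-cong pats (λ bs → oddIndicator (countTrue bs) (X bs)) ⟩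
    sumOver (λ bs → ½ * ((1ℚ ^ℚ countTrue bs) * X bs - ((- 1ℚ) ^ℚ countTrue bs) * X bs)) pats
  ≡⟨ sumOver-*ˡ pats ½ _ ⟩
    ½ * sumOver (λ bs → (1ℚ ^ℚ countTrue bs) * X bs - ((- 1ℚ) ^ℚ countTrue bs) * X bs) pats
  ≡⟨ cong (½ *_) (sumOver-- pats _ _) ⟩
    ½ * (patternSum 1ℚ N as - patternSum (- 1ℚ) N as)
  ∎
  where
  open ≡-Reasoning
  pats : List (List Bool)
  pats = patterns (length as)
  X : List Bool → ℚ
  X bs = ζbarN N bs as

Σodd-Lpζ≡oddPatternSum : ∀ as N →
  sumTo (length as) (λ p → if oddᵇ p then LpζN N p as else 0ℚ)
  ≡ sumOver (λ bs → if oddᵇ (countTrue bs) then ζbarN N bs as else 0ℚ) (patterns (length as))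
Σodd-Lpζ≡oddPatternSum as N = begin
    sumTo k (λ p → if oddᵇ p then LpζN N p as else 0ℚ)
  ≡⟨ sumTo-cong k (λ p → trans (if-sumOver (oddᵇ p))
       (sumOver-cong pats (λ bs → if-swap (oddᵇ p) (countTrue bs ≡ᵇ p)))) ⟩
    sumTo k (λ p → sumOver (λ bs → G bs p) pats)
  ≡⟨ sumOver-sumTo-comm pats k G ⟨
    sumOver (λ bs → sumTo k (G bs)) pats
  ≡⟨ sumOver-patterns-cong k _ _ (λ bs ≤k →
       sumTo-indicator k (countTrue bs) (λ p → if oddᵇ p then X bs else 0ℚ) refl ≤k) ⟩
    sumOver (λ bs → if oddᵇ (countTrue bs) then X bs else 0ℚ) pats
  ∎
  where
  open ≡-Reasoning
  k : ℕ
  k = length as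
  pats : List (List Bool)
  pats = patterns k
  X : List Bool → ℚ
  X bs = ζbarN N bs as
  G : List Bool → ℕ → ℚ
  G bs p = if countTrue bs ≡ᵇ p then (if oddᵇ p then X bs else 0ℚ) else 0ℚ
  if-sumOver : ∀ {f : List Bool → ℚ} b →
    (if b then sumOver f pats else 0ℚ) ≡ sumOver (λ bs → if b then f bs else 0ℚ) pats
  if-sumOver true  = refl
  if-sumOver false = sym (sumOver-0 pats)
  if-swap : ∀ b c {x : ℚ} →
    (if b then (if c then x else 0ℚ) else 0ℚ) ≡ (if c then (if b then x else 0ℚ) else 0ℚ)
  if-swap true  c     = refl
  if-swap false true  = refl
  if-swap false false = refl

Σodd-Lpζ-closedForm : ∀ as N →
  sumTo (length as) (λ p → if oddᵇ p then LpζN N p as else 0ℚ)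
  ≡ ½ * ((2ℚ ^ℚ length as) * ((½ ^ℚ weight as) * ζN ⌊ N /2⌋ as) - (2ℚ ^ℚ length as) * tN N as)
Σodd-Lpζ-closedForm as N = begin
    sumTo (length as) (λ p → if oddᵇ p then LpζN N p as else 0ℚ)
  ≡⟨ Σodd-Lpζ≡oddPatternSum as N ⟩
    sumOver (λ bs → if oddᵇ (countTrue bs) then ζbarN N bs as else 0ℚ) (patterns (length as))
  ≡⟨ oddPatternSum as N ⟩
    ½ * (patternSum 1ℚ N as - patternSum (- 1ℚ) N as)
  ≡⟨ cong₂ (λ u v → ½ * (u - v)) (patternSum-1 as N) (patternSum-−1 as N) ⟩
    ½ * ((2ℚ ^ℚ length as) * ((½ ^ℚ weight as) * ζN ⌊ N /2⌋ as) - (2ℚ ^ℚ length as) * tN N as)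
  ∎
  where open ≡-Reasoning

finite-identity : ∀ a₁ as N → let L = a₁ ∷ as in
  tN N L - rhsN N L ≡ (½ ^ℚ weight L) * (ζN ⌊ N /2⌋ L - ζN N L)
finite-identity a₁ as N = begin
    t - (½^w * z - ½^j * sumTo (length L) (λ p → if oddᵇ p then LpζN N p L else 0ℚ))
  ≡⟨ cong (λ s → t - (½^w * z - ½^j * s)) (Σodd-Lpζ-closedForm L N) ⟩
    t - (½^w * z - ½^j * (½ * (2ℚ * 2^j * (½^w * z′) - 2ℚ * 2^j * t)))
  ≡⟨ rearrange t ½^w z z′ ½^j 2^j ⟩
    t - ½^w * z + ½^j * 2^j * (½^w * z′ - t)
  ≡⟨ cong (λ c → t - ½^w * z + c * (½^w * z′ - t)) (½^n*2^n (length as)) ⟩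
    t - ½^w * z + 1ℚ * (½^w * z′ - t)
  ≡⟨ collapse t ½^w z z′ ⟩
    ½^w * (z′ - z)
  ∎
  where
  open ≡-Reasoning
  L : List ℕ
  L = a₁ ∷ as
  w : ℕ
  w = weight L
  t z z′ ½^w ½^j 2^j : ℚ
  t   = tN N L
  z   = ζN N L
  z′  = ζN ⌊ N /2⌋ L
  ½^w = ½ ^ℚ weight L
  ½^j = ½ ^ℚ length as
  2^j = 2ℚ ^ℚ length as
  rearrange : ∀ t h z z′ a b →
    t - (h * z - a * (½ * (2ℚ * b * (h * z′) - 2ℚ * b * t))) ≡ t - h * z + a * b * (h * z′ - t)
  rearrange = solve-∀ ℚ-ring
  collapse : ∀ t h z z′ → t - h * z + 1ℚ * (h * z′ - t) ≡ h * (z′ - z)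
  collapse = solve-∀ ℚ-ring

-- Inequalities

*-monoˡ-≤-0≤ : ∀ {r p q : ℚ} → 0ℚ ≤ℚ r → p ≤ℚ q → r * p ≤ℚ r * q
*-monoˡ-≤-0≤ {r} 0≤r = ℚP.*-monoˡ-≤-nonNeg r {{ℚ.nonNegative 0≤r}}

*-monoʳ-≤-0≤ : ∀ {r p q : ℚ} → 0ℚ ≤ℚ r → p ≤ℚ q → p * r ≤ℚ q * r
*-monoʳ-≤-0≤ {r} 0≤r = ℚP.*-monoʳ-≤-nonNeg r {{ℚ.nonNegative 0≤r}}

*-mono-≤-0≤ : ∀ {a b c d : ℚ} → 0ℚ ≤ℚ a → a ≤ℚ b → 0ℚ ≤ℚ c → c ≤ℚ d → a * c ≤ℚ b * d
*-mono-≤-0≤ 0≤a a≤b 0≤c c≤d =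
  ℚP.≤-trans (*-monoʳ-≤-0≤ 0≤c a≤b) (*-monoˡ-≤-0≤ (ℚP.≤-trans 0≤a a≤b) c≤d)

*-nonNeg : ∀ {a b : ℚ} → 0ℚ ≤ℚ a → 0ℚ ≤ℚ b → 0ℚ ≤ℚ a * b
*-nonNeg 0≤a 0≤b = *-mono-≤-0≤ ℚP.≤-refl 0≤a ℚP.≤-refl 0≤b

x≤x+nonNeg : ∀ (x : ℚ) {y} → 0ℚ ≤ℚ y → x ≤ℚ x + y
x≤x+nonNeg x 0≤y = ℚP.≤-trans (ℚP.≤-reflexive (sym (ℚP.+-identityʳ x))) (ℚP.+-monoʳ-≤ x 0≤y)

x≤y+z⇒x-y≤z : ∀ {x y z : ℚ} → x ≤ℚ y + z → x - y ≤ℚ z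
x≤y+z⇒x-y≤z {x} {y} {z} x≤y+z =
  ℚP.≤-trans (ℚP.+-monoˡ-≤ (- y) x≤y+z) (ℚP.≤-reflexive (lemma y z))
  where
  lemma : ∀ y z → y + z - y ≡ z
  lemma = solve-∀ ℚ-ring

^ℚ-nonNeg : ∀ {x} n → 0ℚ ≤ℚ x → 0ℚ ≤ℚ x ^ℚ n
^ℚ-nonNeg zero    0≤x = ℚP.nonNegative⁻¹ 1ℚ
^ℚ-nonNeg (suc n) 0≤x = *-nonNeg 0≤x (^ℚ-nonNeg n 0≤x)

^ℚ-mono-≤ : ∀ {x y} n → 0ℚ ≤ℚ x → x ≤ℚ y → x ^ℚ n ≤ℚ y ^ℚ n
^ℚ-mono-≤ zero    0≤x x≤y = ℚP.≤-refl
^ℚ-mono-≤ (suc n) 0≤x x≤y = *-mono-≤-0≤ 0≤x x≤y (^ℚ-nonNeg n 0≤x) (^ℚ-mono-≤ n 0≤x x≤y)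

^ℚ≤1 : ∀ {x} n → 0ℚ ≤ℚ x → x ≤ℚ 1ℚ → x ^ℚ n ≤ℚ 1ℚ
^ℚ≤1 n 0≤x x≤1 = ℚP.≤-trans (^ℚ-mono-≤ n 0≤x x≤1) (ℚP.≤-reflexive (1^ℚ n))

∣c*[x-y]∣≤y-x : ∀ {c x y : ℚ} → 0ℚ ≤ℚ c → c ≤ℚ 1ℚ → x ≤ℚ y → ∣ c * (x - y) ∣ ≤ℚ y - x
∣c*[x-y]∣≤y-x {c} {x} {y} 0≤c c≤1 x≤y = begin
  ∣ c * (x - y) ∣      ≡⟨ cong ∣_∣ (lemma c x y) ⟩
  ∣ - (c * (y - x)) ∣  ≡⟨ ℚP.∣-p∣≡∣p∣ (c * (y - x)) ⟩
  ∣ c * (y - x) ∣      ≡⟨ ℚP.0≤p⇒∣p∣≡p (*-nonNeg 0≤c 0≤y-x) ⟩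
  c * (y - x)          ≤⟨ *-monoʳ-≤-0≤ 0≤y-x c≤1 ⟩
  1ℚ * (y - x)         ≡⟨ ℚP.*-identityˡ (y - x) ⟩
  y - x                ∎
  where
  open ℚP.≤-Reasoning
  0≤y-x : 0ℚ ≤ℚ y - x
  0≤y-x = ℚP.≤-trans (ℚP.≤-reflexive (sym (ℚP.+-inverseʳ x))) (ℚP.+-monoˡ-≤ (- x) x≤y)
  lemma : ∀ c x y → c * (x - y) ≡ - (c * (y - x))
  lemma = solve-∀ ℚ-ring

fromℕ-nonNeg : ∀ n → 0ℚ ≤ℚ fromℕ n
fromℕ-nonNeg zero    = ℚP.≤-refl
fromℕ-nonNeg (suc n) = ℚP.+-mono-≤ (fromℕ-nonNeg n) (ℚP.nonNegative⁻¹ 1ℚ)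

fromℕ-mono-≤ : ∀ {m n} → m ℕ.≤ n → fromℕ m ≤ℚ fromℕ n
fromℕ-mono-≤ {m} {n} m≤n = ℚP.≤-trans (x≤x+nonNeg (fromℕ m) (fromℕ-nonNeg (n ℕ.∸ m)))
  (ℚP.≤-reflexive (trans (sym (fromℕ-+ m (n ℕ.∸ m))) (cong fromℕ (ℕP.m+[n∸m]≡n m≤n))))

1/suc-nonNeg : ∀ m → 0ℚ ≤ℚ 1/suc m
1/suc-nonNeg m = subst (0ℚ ≤ℚ_) (sym (ℚP.normalize-coprime (Coprime.1-coprimeTo (suc m))))
  (ℚP.nonNegative⁻¹ _)

1/suc-antitone : ∀ {m m′} → m ℕ.≤ m′ → 1/suc m′ ≤ℚ 1/suc m
1/suc-antitone {m} {m′} m≤m′ = begin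
    1/suc m′
  ≡⟨ sym (ℚP.*-identityʳ (1/suc m′)) ⟩
    1/suc m′ * 1ℚ
  ≡⟨ cong (1/suc m′ *_) (sym (fromℕ*1/suc m)) ⟩
    1/suc m′ * (fromℕ (suc m) * 1/suc m)
  ≤⟨ *-monoˡ-≤-0≤ (1/suc-nonNeg m′) (*-monoʳ-≤-0≤ (1/suc-nonNeg m) (fromℕ-mono-≤ (ℕ.s≤s m≤m′))) ⟩
    1/suc m′ * (fromℕ (suc m′) * 1/suc m)
  ≡⟨ lemma (1/suc m′) (fromℕ (suc m′)) (1/suc m) ⟩
    fromℕ (suc m′) * 1/suc m′ * 1/suc m
  ≡⟨ cong (_* 1/suc m) (fromℕ*1/suc m′) ⟩
    1ℚ * 1/suc m
  ≡⟨ ℚP.*-identityˡ (1/suc m) ⟩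
    1/suc m
  ∎
  where
  open ℚP.≤-Reasoning
  lemma : ∀ r n s → r * (n * s) ≡ n * r * s
  lemma = solve-∀ ℚ-ring

1/suc≤1 : ∀ m → 1/suc m ≤ℚ 1ℚ
1/suc≤1 m = 1/suc-antitone {0} {m} ℕ.z≤n

½^n-nonNeg : ∀ n → 0ℚ ≤ℚ ½ ^ℚ n
½^n-nonNeg n = ^ℚ-nonNeg n (1/suc-nonNeg 1)

½^n≤1 : ∀ n → ½ ^ℚ n ≤ℚ 1ℚ
½^n≤1 n = ^ℚ≤1 n (1/suc-nonNeg 1) (1/suc≤1 1)

1/suc*fromℕ≤1/suc : ∀ P M K → P ℕ.* suc K ℕ.≤ suc M → 1/suc M * fromℕ P ≤ℚ 1/suc K
1/suc*fromℕ≤1/suc P M K P[1+K]≤1+M = begin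
    1/suc M * fromℕ P
  ≡⟨ sym (ℚP.*-identityʳ _) ⟩
    1/suc M * fromℕ P * 1ℚ
  ≡⟨ cong (1/suc M * fromℕ P *_) (sym (fromℕ*1/suc K)) ⟩
    1/suc M * fromℕ P * (fromℕ (suc K) * 1/suc K)
  ≡⟨ lemma (1/suc M) (fromℕ P) (fromℕ (suc K)) (1/suc K) ⟩
    1/suc M * (fromℕ P * fromℕ (suc K)) * 1/suc K
  ≡⟨ cong (λ z → 1/suc M * z * 1/suc K) (sym (fromℕ-* P (suc K))) ⟩
    1/suc M * fromℕ (P ℕ.* suc K) * 1/suc K
  ≤⟨ *-monoʳ-≤-0≤ (1/suc-nonNeg K) (*-monoˡ-≤-0≤ (1/suc-nonNeg M) (fromℕ-mono-≤ P[1+K]≤1+M)) ⟩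
    1/suc M * fromℕ (suc M) * 1/suc K
  ≡⟨ cong (_* 1/suc K) (trans (ℚP.*-comm (1/suc M) _) (fromℕ*1/suc M)) ⟩
    1ℚ * 1/suc K
  ≡⟨ ℚP.*-identityˡ (1/suc K) ⟩
    1/suc K
  ∎
  where
  open ℚP.≤-Reasoning
  lemma : ∀ a b c d → a * b * (c * d) ≡ a * (b * c) * d
  lemma = solve-∀ ℚ-ring

sumTo-nonNeg : ∀ N (g : ℕ → ℚ) → (∀ n → n ℕ.≤ N → 0ℚ ≤ℚ g n) → 0ℚ ≤ℚ sumTo N g
sumTo-nonNeg zero    g 0≤g = ℚP.≤-refl
sumTo-nonNeg (suc N) g 0≤g = ℚP.+-mono-≤
  (sumTo-nonNeg N g (λ n n≤N → 0≤g n (ℕP.m≤n⇒m≤1+n n≤N))) (0≤g (suc N) ℕP.≤-refl)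

sumTo-mono-≤ : ∀ N (f g : ℕ → ℚ) → (∀ n → n ℕ.≤ N → f n ≤ℚ g n) → sumTo N f ≤ℚ sumTo N g
sumTo-mono-≤ zero    f g f≤g = ℚP.≤-refl
sumTo-mono-≤ (suc N) f g f≤g = ℚP.+-mono-≤
  (sumTo-mono-≤ N f g (λ n n≤N → f≤g n (ℕP.m≤n⇒m≤1+n n≤N))) (f≤g (suc N) ℕP.≤-refl)

sumTo-monoˡ-≤ : ∀ {M N} (g : ℕ → ℚ) → M ℕ.≤ N →
  (∀ n → M ℕ.< n → n ℕ.≤ N → 0ℚ ≤ℚ g n) → sumTo M g ≤ℚ sumTo N g
sumTo-monoˡ-≤ {M} {zero}  g ℕ.z≤n 0≤g = ℚP.≤-refl
sumTo-monoˡ-≤ {M} {suc N} g M≤N   0≤g with ℕP.m≤n⇒m<n∨m≡n M≤N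
... | inj₂ refl = ℚP.≤-refl
... | inj₁ M<N  = ℚP.≤-trans
  (sumTo-monoˡ-≤ g (ℕP.≤-pred M<N) (λ n M<n n≤N → 0≤g n M<n (ℕP.m≤n⇒m≤1+n n≤N)))
  (x≤x+nonNeg (sumTo N g) (0≤g (suc N) M<N ℕP.≤-refl))

sumTo-tail≤ : ∀ {M N} (g : ℕ → ℚ) (β : ℚ) → M ℕ.≤ N →
  (∀ n → M ℕ.< n → n ℕ.≤ N → g n ≤ℚ β) → sumTo N g ≤ℚ sumTo M g + fromℕ (N ℕ.∸ M) * β
sumTo-tail≤ {M} {zero}  g β ℕ.z≤n g≤β =
  ℚP.≤-reflexive (sym (trans (cong (0ℚ +_) (ℚP.*-zeroˡ β)) (ℚP.+-identityʳ 0ℚ)))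
sumTo-tail≤ {M} {suc N} g β M≤N   g≤β with ℕP.m≤n⇒m<n∨m≡n M≤N
... | inj₂ refl = ℚP.≤-reflexive (sym (trans
      (cong (λ k → sumTo (suc N) g + fromℕ k * β) (ℕP.n∸n≡0 (suc N)))
      (trans (cong (sumTo (suc N) g +_) (ℚP.*-zeroˡ β)) (ℚP.+-identityʳ _))))
... | inj₁ M<N  = begin
    sumTo N g + g (suc N)
  ≤⟨ ℚP.+-mono-≤ (sumTo-tail≤ g β M≤N′ (λ n M<n n≤N → g≤β n M<n (ℕP.m≤n⇒m≤1+n n≤N)))
                 (g≤β (suc N) M<N ℕP.≤-refl) ⟩
    sumTo M g + fromℕ (N ℕ.∸ M) * β + β
  ≡⟨ lemma (sumTo M g) (fromℕ (N ℕ.∸ M)) β ⟩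
    sumTo M g + fromℕ (suc (N ℕ.∸ M)) * β
  ≡⟨ cong (λ k → sumTo M g + fromℕ k * β) (sym (ℕP.+-∸-assoc 1 M≤N′)) ⟩
    sumTo M g + fromℕ (suc N ℕ.∸ M) * β
  ∎
  where
  open ℚP.≤-Reasoning
  M≤N′ : M ℕ.≤ N
  M≤N′ = ℕP.≤-pred M<N
  lemma : ∀ s n β → s + n * β + β ≡ s + (n + 1ℚ) * β
  lemma = solve-∀ ℚ-ring

inv-pow-nonNeg : ∀ n a → 0ℚ ≤ℚ inv-pow n a
inv-pow-nonNeg zero    a = ℚP.≤-refl
inv-pow-nonNeg (suc m) a = ^ℚ-nonNeg a (1/suc-nonNeg m)

inv-pow-antitoneʳ : ∀ n {a} → 1 ℕ.≤ a → inv-pow n a ≤ℚ inv-pow n 1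
inv-pow-antitoneʳ zero    _           = ℚP.≤-refl
inv-pow-antitoneʳ (suc m) {suc a} _ =
  *-monoˡ-≤-0≤ (1/suc-nonNeg m) (^ℚ≤1 a (1/suc-nonNeg m) (1/suc≤1 m))

inv-pow≤1/suc² : ∀ {M k a} → M ℕ.≤ k → 2 ℕ.≤ a → inv-pow (suc k) a ≤ℚ 1/suc M * 1/suc M
inv-pow≤1/suc² {M} {k} {suc (suc a)} M≤k (ℕ.s≤s (ℕ.s≤s ℕ.z≤n)) = begin
  r * (r * r ^ℚ a)     ≤⟨ *-mono-≤-0≤ 0≤r r≤1/suc-M (*-nonNeg 0≤r (^ℚ-nonNeg a 0≤r))
                            (*-mono-≤-0≤ 0≤r r≤1/suc-M (^ℚ-nonNeg a 0≤r) (^ℚ≤1 a 0≤r (1/suc≤1 k))) ⟩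
  1/suc M * (1/suc M * 1ℚ) ≡⟨ cong (1/suc M *_) (ℚP.*-identityʳ (1/suc M)) ⟩
  1/suc M * 1/suc M    ∎
  where
  open ℚP.≤-Reasoning
  r : ℚ
  r = 1/suc k
  0≤r : 0ℚ ≤ℚ r
  0≤r = 1/suc-nonNeg k
  r≤1/suc-M : r ≤ℚ 1/suc M
  r≤1/suc-M = 1/suc-antitone M≤k

upperHalf-average≤ : ∀ N X → 0ℚ ≤ℚ X → fromℕ (N ℕ.∸ ⌊ N /2⌋) * (1/suc ⌊ N /2⌋ * X) ≤ℚ X
upperHalf-average≤ N X 0≤X = begin
  fromℕ (N ℕ.∸ M) * (1/suc M * X)  ≤⟨ *-monoʳ-≤-0≤ (*-nonNeg (1/suc-nonNeg M) 0≤X)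
                                        (fromℕ-mono-≤ (n∸⌊n/2⌋≤1+⌊n/2⌋ N)) ⟩
  fromℕ (suc M) * (1/suc M * X)    ≡⟨ sym (ℚP.*-assoc (fromℕ (suc M)) (1/suc M) X) ⟩
  fromℕ (suc M) * 1/suc M * X      ≡⟨ cong (_* X) (fromℕ*1/suc M) ⟩
  1ℚ * X                           ≡⟨ ℚP.*-identityˡ X ⟩
  X                                ∎
  where
  open ℚP.≤-Reasoning
  M : ℕ
  M = ⌊ N /2⌋

-- Harmonic numbers and the tail of ζ

harmonic : ℕ → ℚ
harmonic N = sumTo N (λ n → inv-pow n 1)

harmonic-nonNeg : ∀ N → 0ℚ ≤ℚ harmonic N
harmonic-nonNeg N = sumTo-nonNeg N _ (λ n _ → inv-pow-nonNeg n 1)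

harmonic-mono-≤ : ∀ {M N} → M ℕ.≤ N → harmonic M ≤ℚ harmonic N
harmonic-mono-≤ M≤N = sumTo-monoˡ-≤ _ M≤N (λ n _ _ → inv-pow-nonNeg n 1)

harmonic-halving : ∀ N → harmonic N ≤ℚ harmonic ⌊ N /2⌋ + 1ℚ
harmonic-halving N = begin
    harmonic N
  ≤⟨ sumTo-tail≤ (λ n → inv-pow n 1) (1/suc M) (⌊n/2⌋≤n N) reciprocal≤ ⟩
    harmonic M + fromℕ (N ℕ.∸ M) * 1/suc M
  ≡⟨ cong (λ r → harmonic M + fromℕ (N ℕ.∸ M) * r) (sym (ℚP.*-identityʳ (1/suc M))) ⟩
    harmonic M + fromℕ (N ℕ.∸ M) * (1/suc M * 1ℚ)
  ≤⟨ ℚP.+-monoʳ-≤ (harmonic M) (upperHalf-average≤ N 1ℚ (ℚP.nonNegative⁻¹ 1ℚ)) ⟩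
    harmonic M + 1ℚ
  ∎
  where
  open ℚP.≤-Reasoning
  M : ℕ
  M = ⌊ N /2⌋
  reciprocal≤ : ∀ n → M ℕ.< n → n ℕ.≤ N → inv-pow n 1 ≤ℚ 1/suc M
  reciprocal≤ (suc m) (ℕ.s≤s M≤m) _ =
    ℚP.≤-trans (ℚP.≤-reflexive (ℚP.*-identityʳ (1/suc m))) (1/suc-antitone M≤m)

harmonic≤log : ∀ L N → N ℕ.< 2 ^ L → harmonic N ≤ℚ fromℕ L
harmonic≤log zero    zero    _         = ℚP.≤-refl
harmonic≤log zero    (suc N) (ℕ.s≤s ())
harmonic≤log (suc L) N       N<2^[1+L] = ℚP.≤-trans (harmonic-halving N)
  (ℚP.+-monoˡ-≤ 1ℚ (harmonic≤log L ⌊ N /2⌋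
    (n<m+m⇒⌊n/2⌋<m N (2 ^ L) (ℕP.≤-trans N<2^[1+L] (ℕP.≤-reflexive (2^suc L))))))

ReciprocallyBounded : (ℕ → ℚ) → Set
ReciprocallyBounded f = ∀ n → 0ℚ ≤ℚ f n × f n ≤ℚ inv-pow n 1

msum-bounds : ∀ fs → All ReciprocallyBounded fs → ∀ N →
  0ℚ ≤ℚ msum N fs × msum N fs ≤ℚ harmonic N ^ℚ length fs
msum-bounds []       All.[]                     N = ℚP.nonNegative⁻¹ 1ℚ , ℚP.≤-refl
msum-bounds (f ∷ fs) (f-bounded All.∷ fs-bounded) N =
  sumTo-nonNeg N _ (λ n _ → *-nonNeg (proj₁ (f-bounded n)) (proj₁ (rest (n ℕ.∸ 1)))) ,
  (begin
    sumTo N (λ n → f n * msum (n ℕ.∸ 1) fs)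
  ≤⟨ sumTo-mono-≤ N _ _ (λ n n≤N → *-mono-≤-0≤ (proj₁ (f-bounded n)) (proj₂ (f-bounded n))
                                                (proj₁ (rest (n ℕ.∸ 1))) (rest≤ n n≤N)) ⟩
    sumTo N (λ n → inv-pow n 1 * Hᵐ)
  ≡⟨ trans (sumTo-cong N (λ n → ℚP.*-comm (inv-pow n 1) Hᵐ)) (sumTo-*ˡ N Hᵐ _) ⟩
    Hᵐ * harmonic N
  ≡⟨ ℚP.*-comm Hᵐ (harmonic N) ⟩
    harmonic N ^ℚ suc (length fs)
  ∎)
  where
  open ℚP.≤-Reasoning
  rest : ∀ N → 0ℚ ≤ℚ msum N fs × msum N fs ≤ℚ harmonic N ^ℚ length fs
  rest = msum-bounds fs fs-bounded
  Hᵐ : ℚ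
  Hᵐ = harmonic N ^ℚ length fs
  rest≤ : ∀ n → n ℕ.≤ N → msum (n ℕ.∸ 1) fs ≤ℚ Hᵐ
  rest≤ n n≤N = ℚP.≤-trans (proj₂ (rest (n ℕ.∸ 1)))
    (^ℚ-mono-≤ (length fs) (harmonic-nonNeg (n ℕ.∸ 1)) (harmonic-mono-≤ (ℕP.≤-trans (ℕP.m∸n≤m n 1) n≤N)))

term-reciprocallyBounded : ∀ {a} → 1 ℕ.≤ a → ReciprocallyBounded (term false a)
term-reciprocallyBounded {a} 1≤a n =
  subst (0ℚ ≤ℚ_) (sym (ℚP.*-identityˡ _)) (inv-pow-nonNeg n a) ,
  ℚP.≤-trans (ℚP.≤-reflexive (ℚP.*-identityˡ _)) (inv-pow-antitoneʳ n 1≤a)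

ζN-bounds : ∀ {as} → All (1 ℕ.≤_) as → ∀ N →
  0ℚ ≤ℚ ζN N as × ζN N as ≤ℚ harmonic N ^ℚ length as
ζN-bounds {as} 1≤as N =
  subst (λ m → 0ℚ ≤ℚ ζN N as × ζN N as ≤ℚ harmonic N ^ℚ m) (ListP.length-map (term false) as)
        (msum-bounds (map (term false) as) (bounded 1≤as) N)
  where
  bounded : ∀ {as} → All (1 ℕ.≤_) as → All ReciprocallyBounded (map (term false) as)
  bounded All.[]           = All.[]
  bounded (1≤a All.∷ 1≤as) = term-reciprocallyBounded 1≤a All.∷ bounded 1≤as

ζN-upperHalf : ∀ {a₁ as} → 2 ℕ.≤ a₁ → All (1 ℕ.≤_) as → ∀ N → let M = ⌊ N /2⌋ ; L = a₁ ∷ as in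
  ζN M L ≤ℚ ζN N L × ζN N L - ζN M L ≤ℚ 1/suc M * harmonic N ^ℚ length as
ζN-upperHalf {a₁} {as} 2≤a₁ 1≤as N =
  sumTo-monoˡ-≤ g (⌊n/2⌋≤n N) (λ n _ _ → 0≤g n) ,
  x≤y+z⇒x-y≤z (ℚP.≤-trans (sumTo-tail≤ g (1/suc M * (1/suc M * Hᵐ)) (⌊n/2⌋≤n N) g≤)
    (ℚP.+-monoʳ-≤ (ζN M (a₁ ∷ as)) (upperHalf-average≤ N (1/suc M * Hᵐ)
      (*-nonNeg (1/suc-nonNeg M) (^ℚ-nonNeg m (harmonic-nonNeg N))))))
  where
  M m : ℕ
  M = ⌊ N /2⌋
  m = length as
  Hᵐ : ℚ
  Hᵐ = harmonic N ^ℚ m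
  g : ℕ → ℚ
  g n = term false a₁ n * ζN (n ℕ.∸ 1) as
  0≤term : ∀ n → 0ℚ ≤ℚ term false a₁ n
  0≤term n = proj₁ (term-reciprocallyBounded (ℕP.≤-trans (ℕ.s≤s ℕ.z≤n) 2≤a₁) n)
  0≤g : ∀ n → 0ℚ ≤ℚ g n
  0≤g n = *-nonNeg (0≤term n) (proj₁ (ζN-bounds 1≤as (n ℕ.∸ 1)))
  g≤ : ∀ n → M ℕ.< n → n ℕ.≤ N → g n ≤ℚ 1/suc M * (1/suc M * Hᵐ)
  g≤ (suc k) (ℕ.s≤s M≤k) n≤N = begin
      term false a₁ (suc k) * ζN k as
    ≤⟨ *-mono-≤-0≤ (0≤term (suc k)) term≤ (proj₁ (ζN-bounds 1≤as k)) ζ≤ ⟩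
      1/suc M * 1/suc M * Hᵐ
    ≡⟨ ℚP.*-assoc (1/suc M) (1/suc M) Hᵐ ⟩
      1/suc M * (1/suc M * Hᵐ)
    ∎
    where
    open ℚP.≤-Reasoning
    term≤ : term false a₁ (suc k) ≤ℚ 1/suc M * 1/suc M
    term≤ = ℚP.≤-trans (ℚP.≤-reflexive (ℚP.*-identityˡ _)) (inv-pow≤1/suc² M≤k 2≤a₁)
    ζ≤ : ζN k as ≤ℚ Hᵐ
    ζ≤ = ℚP.≤-trans (proj₂ (ζN-bounds 1≤as k))
      (^ℚ-mono-≤ m (harmonic-nonNeg k) (harmonic-mono-≤ (ℕP.≤-trans (ℕP.n≤1+n k) n≤N)))

polynomial≤exponential : ∀ m C → ∃[ L₀ ] ∀ L → L₀ ℕ.≤ L → C ℕ.* suc L ^ m ℕ.≤ 2 ^ L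
polynomial≤exponential zero    C = C , λ L C≤L →
  ℕP.≤-trans (ℕP.≤-reflexive (ℕP.*-identityʳ C)) (ℕP.≤-trans C≤L (ℕP.<⇒≤ (n<2^n L)))
polynomial≤exponential (suc m) C with polynomial≤exponential m (C ℕ.* 2 ^ suc m)
... | L₀ , bound = L₀ ℕ.+ L₀ , bound′
  where
  bound′ : ∀ L → L₀ ℕ.+ L₀ ℕ.≤ L → C ℕ.* suc L ^ suc m ℕ.≤ 2 ^ L
  bound′ L 2L₀≤L = begin
      C ℕ.* (suc L ℕ.* suc L ^ m)
    ≤⟨ ℕP.*-monoʳ-≤ C (ℕP.*-mono-≤ 1+L≤2s (ℕP.^-monoˡ-≤ m 1+L≤2s)) ⟩
      C ℕ.* (2 ℕ.* s ℕ.* (2 ℕ.* s) ^ m)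
    ≡⟨ cong (λ z → C ℕ.* (2 ℕ.* s ℕ.* z)) (^-distribʳ-* 2 s m) ⟩
      C ℕ.* (2 ℕ.* s ℕ.* (2 ^ m ℕ.* s ^ m))
    ≡⟨ regroup C s (2 ^ m) (s ^ m) ⟩
      C ℕ.* 2 ^ suc m ℕ.* s ^ m ℕ.* s
    ≤⟨ ℕP.*-mono-≤ (bound h L₀≤h) (n<2^n h) ⟩
      2 ^ h ℕ.* 2 ^ h
    ≡⟨ ℕP.^-distribˡ-+-* 2 h h ⟨
      2 ^ (h ℕ.+ h)
    ≤⟨ ℕP.^-monoʳ-≤ 2 (2⌊n/2⌋≤n L) ⟩
      2 ^ L
    ∎
    where
    open ℕP.≤-Reasoning
    h s : ℕ
    h = ⌊ L /2⌋
    s = suc h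
    L₀≤h : L₀ ℕ.≤ h
    L₀≤h = ℕP.≤-trans (ℕP.≤-reflexive (ℕP.n≡⌊n+n/2⌋ L₀)) (ℕP.⌊n/2⌋-mono 2L₀≤L)
    double-suc : ∀ h → suc (suc (h ℕ.+ h)) ≡ 2 ℕ.* suc h
    double-suc = ℕSolver.solve-∀
    1+L≤2s : suc L ℕ.≤ 2 ℕ.* s
    1+L≤2s = ℕP.≤-trans (ℕ.s≤s (n≤1+2⌊n/2⌋ L)) (ℕP.≤-reflexive (double-suc h))
    interchange-* : ∀ (a b x y : ℕ) → a ℕ.* b ℕ.* (x ℕ.* y) ≡ a ℕ.* x ℕ.* (b ℕ.* y)
    interchange-* = ℕSolver.solve-∀
    ^-distribʳ-* : ∀ a b n → (a ℕ.* b) ^ n ≡ a ^ n ℕ.* b ^ n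
    ^-distribʳ-* a b zero    = refl
    ^-distribʳ-* a b (suc n) =
      trans (cong (a ℕ.* b ℕ.*_) (^-distribʳ-* a b n)) (interchange-* a b (a ^ n) (b ^ n))
    regroup : ∀ (C s x y : ℕ) → C ℕ.* (2 ℕ.* s ℕ.* (x ℕ.* y)) ≡ C ℕ.* (2 ℕ.* x) ℕ.* y ℕ.* s
    regroup = ℕSolver.solve-∀

halfTail-eventually≤ : ∀ m K →
  ∃[ N₀ ] ∀ N → N₀ ℕ.≤ N → 1/suc ⌊ N /2⌋ * harmonic N ^ℚ m ≤ℚ 1/suc K
halfTail-eventually≤ m K with polynomial≤exponential m (suc K ℕ.+ suc K)
... | L₀ , poly≤exp = 2 ^ L₀ , small
  where
  small : ∀ N → 2 ^ L₀ ℕ.≤ N → 1/suc ⌊ N /2⌋ * harmonic N ^ℚ m ≤ℚ 1/suc K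
  small N 2^L₀≤N with dyadic-bracket N (ℕP.≤-trans (1≤2^n L₀) 2^L₀≤N)
  ... | L , 2^L≤N , N<2^[1+L] = begin
        1/suc M * harmonic N ^ℚ m
      ≤⟨ *-monoˡ-≤-0≤ (1/suc-nonNeg M) (^ℚ-mono-≤ m (harmonic-nonNeg N) (harmonic≤log (suc L) N N<2^[1+L])) ⟩
        1/suc M * fromℕ (suc L) ^ℚ m
      ≡⟨ cong (1/suc M *_) (fromℕ-^ (suc L) m) ⟩
        1/suc M * fromℕ P
      ≤⟨ 1/suc*fromℕ≤1/suc P M K P[1+K]≤1+M ⟩
        1/suc K
      ∎
    where
    open ℚP.≤-Reasoning
    M P : ℕ
    M = ⌊ N /2⌋
    P = suc L ^ m
    [1+K]P≤M : suc K ℕ.* P ℕ.≤ M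
    [1+K]P≤M = m+m≤n⇒m≤⌊n/2⌋ (suc K ℕ.* P) N
      (ℕP.≤-trans (ℕP.≤-reflexive (sym (ℕP.*-distribʳ-+ P (suc K) (suc K))))
        (ℕP.≤-trans (poly≤exp L (2^a≤n<2^[1+b]⇒a≤b 2^L₀≤N N<2^[1+L])) 2^L≤N))
    P[1+K]≤1+M : P ℕ.* suc K ℕ.≤ suc M
    P[1+K]≤1+M = ℕP.≤-trans (ℕP.≤-reflexive (ℕP.*-comm P (suc K))) (ℕP.m≤n⇒m≤1+n [1+K]P≤M)

archimedean : ∀ ε → 0ℚ <ℚ ε → ∃[ K ] 1/suc K <ℚ ε
archimedean (mkℚ (ℤ.+ 0)     d c) 0<ε = ⊥-elim (ℤ.Positive.pos (ℚ.positive 0<ε))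
archimedean (mkℚ ℤ.-[1+ n ]  d c) 0<ε = ⊥-elim (ℤ.Positive.pos (ℚ.positive 0<ε))
archimedean (mkℚ (ℤ.+ suc n) d c) 0<ε = suc d ,
  subst (_<ℚ mkℚ (ℤ.+ suc n) d c) (sym (ℚP.normalize-coprime (Coprime.1-coprimeTo (suc (suc d)))))
    (ℚ.*<* (ℤ.+<+ (ℕP.≤-trans (ℕ.s≤s (ℕP.≤-reflexive (ℕP.*-identityˡ (suc d))))
                              (ℕP.m≤n*m (suc (suc d)) (suc n)))))

corollary3p3 : (a₁ : ℕ) (as : List ℕ) → 2 ≤ a₁ → All (1 ≤_) as →
    TendsToZero (λ N → tN N (a₁ ∷ as) - rhsN N (a₁ ∷ as))
corollary3p3 a₁ as 2≤a₁ 1≤as ε 0<ε =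
  let K  , 1/suc-K<ε = archimedean ε 0<ε
      N₀ , tail≤     = halfTail-eventually≤ (length as) K
  in N₀ , λ N N₀≤N → let M = ⌊ N /2⌋ ; ζM≤ζN , ζN-ζM≤ = ζN-upperHalf 2≤a₁ 1≤as N in begin-strict
    ∣ tN N L - rhsN N L ∣                    ≡⟨ cong ∣_∣ (finite-identity a₁ as N) ⟩
    ∣ (½ ^ℚ weight L) * (ζN M L - ζN N L) ∣  ≤⟨ ∣c*[x-y]∣≤y-x (½^n-nonNeg w) (½^n≤1 w) ζM≤ζN ⟩
    ζN N L - ζN M L                          ≤⟨ ζN-ζM≤ ⟩
    1/suc M * harmonic N ^ℚ length as        ≤⟨ tail≤ N N₀≤N ⟩
    1/suc K                                  <⟨ 1/suc-K<ε ⟩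
    ε                                        ∎
  where
  open ℚP.≤-Reasoning
  L : List ℕ
  L = a₁ ∷ as
  w : ℕ
  w = weight L
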